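{- Let $S_n=\sum_{k=0}^n\binom{n}{k}^2\binom{2k}{k}(2k+1)$ for $n\geq 0$. Then the sequence $\{S_{n+1}/S_n\}_{n\geq 0}$ is strictly increasing and $\lim_{n\to\infty} S_{n+1}/S_n=9$. -}

module Defs where

open import Data.Nat using (ℕ; zero; suc; _+_; _*_; _^_; _≤_; NonZero; >-nonZero; s≤s; z≤n)
open import Data.Nat.Properties using (≤-trans; m≤m+n)
open import Data.Nat.Combinatorics using (_C_)
open import Data.Integer using (+_)
open import Data.Rational using (ℚ; _/_)

sumTo : (ℕ → ℕ) → ℕ → ℕ
sumTo f zero = f 0
sumTo f (suc n) = sumTo f n + f (suc n)

S : ℕ → ℕ
S n = sumTo (λ k → ((n C k) ^ 2) * ((2 * k) C k) * (2 * k + 1)) n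

sumTo-f0 : ∀ f n → f 0 ≤ sumTo f n
sumTo-f0 f zero = Data.Nat.Properties.≤-refl
sumTo-f0 f (suc n) = ≤-trans (sumTo-f0 f n) (m≤m+n _ _)

S-pos : ∀ n → 1 ≤ S n
S-pos n = ≤-trans (s≤s z≤n) (sumTo-f0 (λ k → ((n C k) ^ 2) * ((2 * k) C k) * (2 * k + 1)) n)

S-nonZero : ∀ n → NonZero (S n)
S-nonZero n = >-nonZero (S-pos n)

ratio : ℕ → ℚ
ratio n = (+ S (suc n) / S n) {{S-nonZero n}}

-- Let A n = Σₖ C(n,k)² C(2k,k). Creative telescoping in k gives the recurrence
--   (n+2)² A (n+2) − (10n² + 30n + 23) A (n+1) + 9 (n+1)² A n = 0
-- and Σₖ (3k − 2n) C(n,k)² C(2k,k) = 0, that is 3 S n = (4n+3) A n.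
-- Induction along the recurrence traps A (n+2) / A (n+1) between two rational functions
-- of n, which for S says 9 − 6/(n+1)² ≤ S (n+1) / S n ≤ 9 − 9/(2(n+1)²) for n ≥ 1; this
-- gives the limit. Between these bounds the recurrence makes A (n+1) A (n+3) large
-- enough for S (n+1)² < S n · S (n+2), which is the monotonicity of S (n+1) / S n.

module Submission where

open import Data.Nat using (ℕ; suc) renaming (_≤_ to _≤ℕ_)
open import Data.Product using (_×_; ∃; _,_)
open import Data.Integer using (+_)
open import Defs

module _ where
  open import Data.Nat using (zero; _+_; _*_; _∸_)
  open import Data.Nat.Properties using (*-zeroʳ; *-identityˡ; *-identityʳ; *-distribˡ-+; *-suc; +-comm; ≤-trans; m≤m+n; n≤1+n; m+n∸m≡n)
  open import Data.Nat.Combinatorics using (_C_; nC1≡n; nCk≡nC[n∸k]; nCk+nC[k+1]≡[n+1]C[k+1])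
  open import Data.Nat.Tactic.RingSolver
  open import Relation.Binary.PropositionalEquality using (_≡_; refl; sym; trans; cong; cong₂; module ≡-Reasoning)
  open ≡-Reasoning

  [k+1]*[n+1]C[k+1]≡[n+1]*nCk : ∀ n k → suc k * (suc n C suc k) ≡ suc n * (n C k)
  [k+1]*[n+1]C[k+1]≡[n+1]*nCk zero    zero    = refl
  [k+1]*[n+1]C[k+1]≡[n+1]*nCk zero    (suc k) = *-zeroʳ (suc (suc k))
  [k+1]*[n+1]C[k+1]≡[n+1]*nCk (suc n) zero    = trans (*-identityˡ _) (trans (nC1≡n (suc (suc n))) (sym (*-identityʳ _)))
  [k+1]*[n+1]C[k+1]≡[n+1]*nCk (suc n) (suc k) = begin
    suc (suc k) * (suc (suc n) C suc (suc k))
      ≡⟨ cong (suc (suc k) *_) (sym (nCk+nC[k+1]≡[n+1]C[k+1] (suc n) (suc k))) ⟩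
    suc (suc k) * (suc n C suc k + suc n C suc (suc k))
      ≡⟨ split (suc k) (suc n C suc k) (suc n C suc (suc k)) ⟩
    suc k * (suc n C suc k) + (suc n C suc k) + suc (suc k) * (suc n C suc (suc k))
      ≡⟨ cong₂ (λ a b → a + (suc n C suc k) + b) ([k+1]*[n+1]C[k+1]≡[n+1]*nCk n k) ([k+1]*[n+1]C[k+1]≡[n+1]*nCk n (suc k)) ⟩
    suc n * (n C k) + (suc n C suc k) + suc n * (n C suc k)
      ≡⟨ merge (suc n) (n C k) (n C suc k) (suc n C suc k) ⟩
    suc n * (n C k + n C suc k) + (suc n C suc k)
      ≡⟨ cong (λ a → suc n * a + (suc n C suc k)) (nCk+nC[k+1]≡[n+1]C[k+1] n k) ⟩
    suc n * (suc n C suc k) + (suc n C suc k)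
      ≡⟨ +-comm (suc n * (suc n C suc k)) _ ⟩
    suc (suc n) * (suc n C suc k)
      ∎
    where
    split : ∀ a x y → suc a * (x + y) ≡ a * x + x + suc a * y
    split = solve-∀
    merge : ∀ m x y z → m * x + z + m * y ≡ m * (x + y) + z
    merge = solve-∀

  [k+1]*nC[k+1]+[k+1]*nCk≡[n+1]*nCk : ∀ n k → suc k * (n C suc k) + suc k * (n C k) ≡ suc n * (n C k)
  [k+1]*nC[k+1]+[k+1]*nCk≡[n+1]*nCk n k = begin
    suc k * (n C suc k) + suc k * (n C k) ≡⟨ sym (*-distribˡ-+ (suc k) (n C suc k) (n C k)) ⟩
    suc k * (n C suc k + n C k)           ≡⟨ cong (suc k *_) (+-comm _ (n C k)) ⟩
    suc k * (n C k + n C suc k)           ≡⟨ cong (suc k *_) (nCk+nC[k+1]≡[n+1]C[k+1] n k) ⟩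
    suc k * (suc n C suc k)               ≡⟨ [k+1]*[n+1]C[k+1]≡[n+1]*nCk n k ⟩
    suc n * (n C k)                       ∎

  [n+1]*[n+1]Ck≡k*[n+1]Ck+[n+1]*nCk : ∀ n k → suc n * (suc n C k) ≡ k * (suc n C k) + suc n * (n C k)
  [n+1]*[n+1]Ck≡k*[n+1]Ck+[n+1]*nCk n zero    = refl
  [n+1]*[n+1]Ck≡k*[n+1]Ck+[n+1]*nCk n (suc k) = begin
    suc n * (suc n C suc k)                     ≡⟨ cong (suc n *_) (sym (nCk+nC[k+1]≡[n+1]C[k+1] n k)) ⟩
    suc n * (n C k + n C suc k)                 ≡⟨ *-distribˡ-+ (suc n) (n C k) _ ⟩
    suc n * (n C k) + suc n * (n C suc k)       ≡⟨ cong (_+ suc n * (n C suc k)) (sym ([k+1]*[n+1]C[k+1]≡[n+1]*nCk n k)) ⟩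
    suc k * (suc n C suc k) + suc n * (n C suc k) ∎

  [2k+1]Ck≡[2k+1]C[k+1] : ∀ k → suc (2 * k) C k ≡ suc (2 * k) C suc k
  [2k+1]Ck≡[2k+1]C[k+1] k = begin
    suc (2 * k) C k               ≡⟨ nCk≡nC[n∸k] (≤-trans (m≤m+n k (k + 0)) (n≤1+n _)) ⟩
    suc (2 * k) C (suc (2 * k) ∸ k) ≡⟨ cong (λ m → suc (2 * k) C (m ∸ k)) (2k+1≡k+[k+1] k) ⟩
    suc (2 * k) C ((k + suc k) ∸ k) ≡⟨ cong (suc (2 * k) C_) (m+n∸m≡n k (suc k)) ⟩
    suc (2 * k) C suc k           ∎
    where
    2k+1≡k+[k+1] : ∀ k → suc (2 * k) ≡ k + suc k
    2k+1≡k+[k+1] = solve-∀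

  [k+1]*[2k+2]C[k+1]≡2*[2k+1]*[2k]Ck : ∀ k → suc k * ((2 * suc k) C suc k) ≡ 2 * (2 * k + 1) * ((2 * k) C k)
  [k+1]*[2k+2]C[k+1]≡2*[2k+1]*[2k]Ck k = begin
    suc k * ((2 * suc k) C suc k)               ≡⟨ cong (λ m → suc k * (m C suc k)) (*-suc 2 k) ⟩
    suc k * (suc (suc (2 * k)) C suc k)          ≡⟨ [k+1]*[n+1]C[k+1]≡[n+1]*nCk (suc (2 * k)) k ⟩
    suc (suc (2 * k)) * (suc (2 * k) C k)        ≡⟨ cong (suc (suc (2 * k)) *_) ([2k+1]Ck≡[2k+1]C[k+1] k) ⟩
    suc (suc (2 * k)) * (suc (2 * k) C suc k)    ≡⟨ double k (suc (2 * k) C suc k) ⟩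
    2 * (suc k * (suc (2 * k) C suc k))          ≡⟨ cong (2 *_) ([k+1]*[n+1]C[k+1]≡[n+1]*nCk (2 * k) k) ⟩
    2 * (suc (2 * k) * ((2 * k) C k))            ≡⟨ reassoc k ((2 * k) C k) ⟩
    2 * (2 * k + 1) * ((2 * k) C k)             ∎
    where
    double : ∀ k x → suc (suc (2 * k)) * x ≡ 2 * (suc k * x)
    double = solve-∀
    reassoc : ∀ k x → 2 * (suc (2 * k) * x) ≡ 2 * (2 * k + 1) * x
    reassoc = solve-∀

module _ where
  open import Data.Nat as ℕ using (zero; z≤n; s≤s; _^_)
  import Data.Nat.Properties as ℕ
  open import Data.Nat.Combinatorics using (_C_; k>n⇒nCk≡0)
  open import Data.List using (List; []; _∷_)
  open import Data.Integer using (ℤ; -_; 0ℤ; _+_; _-_; _*_; _≤_; _<_; +≤+; +<+; nonNegative; positive)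
  open import Data.Integer.Properties
    using ( pos-+; pos-*; +-identityʳ; *-zeroʳ; *-distribˡ-+; *-cancelˡ-≡; i-j≡0⇒i≡j; <⇒≤; _<?_; 0≤i-j⇒j≤i; <-≤-trans
          ; +-mono-≤; +-mono-≤-<; +-mono-<-≤; +-monoʳ-<; *-identityˡ; *-monoˡ-≤-nonNeg; *-monoʳ-≤-nonNeg; *-monoˡ-<-pos; *-monoʳ-<-pos
          ; *-cancelˡ-≤-pos; *-cancelˡ-<-nonNeg; i<j⇒suc[i]≤j; ≤-trans)
  open import Data.Integer.Tactic.RingSolver
  open import Relation.Nullary.Decidable using (toWitness)
  open import Relation.Binary.PropositionalEquality using (_≡_; refl; sym; trans; cong; cong₂; subst; subst₂; module ≡-Reasoning)
  open ≡-Reasoning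

  cong₃ : ∀ (f : ℤ → ℤ → ℤ → ℤ) {a b c a′ b′ c′} → a ≡ a′ → b ≡ b′ → c ≡ c′ → f a b c ≡ f a′ b′ c′
  cong₃ f refl refl refl = refl

  sumToℤ : (ℕ → ℤ) → ℕ → ℤ
  sumToℤ f zero    = f 0
  sumToℤ f (suc n) = sumToℤ f n + f (suc n)

  sumToℤ-cong : ∀ {f g} → (∀ k → f k ≡ g k) → ∀ n → sumToℤ f n ≡ sumToℤ g n
  sumToℤ-cong f≗g zero    = f≗g 0
  sumToℤ-cong f≗g (suc n) = cong₂ _+_ (sumToℤ-cong f≗g n) (f≗g (suc n))

  sumToℤ-+ : ∀ f g n → sumToℤ (λ k → f k + g k) n ≡ sumToℤ f n + sumToℤ g n
  sumToℤ-+ f g zero    = refl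
  sumToℤ-+ f g (suc n) = trans (cong (_+ (f (suc n) + g (suc n))) (sumToℤ-+ f g n))
                               (interchange (sumToℤ f n) (sumToℤ g n) (f (suc n)) (g (suc n)))
    where
    interchange : ∀ a b c d → a + b + (c + d) ≡ a + c + (b + d)
    interchange = solve-∀

  sumToℤ-*ˡ : ∀ c f n → sumToℤ (λ k → c * f k) n ≡ c * sumToℤ f n
  sumToℤ-*ˡ c f zero    = refl
  sumToℤ-*ˡ c f (suc n) = trans (cong (_+ c * f (suc n)) (sumToℤ-*ˡ c f n))
                                (sym (*-distribˡ-+ c (sumToℤ f n) (f (suc n))))

  sumToℤ-- : ∀ f g n → sumToℤ (λ k → f k - g k) n ≡ sumToℤ f n - sumToℤ g n
  sumToℤ-- f g zero    = refl
  sumToℤ-- f g (suc n) = trans (cong (_+ (f (suc n) - g (suc n))) (sumToℤ-- f g n))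
                               (interchange (sumToℤ f n) (sumToℤ g n) (f (suc n)) (g (suc n)))
    where
    interchange : ∀ a b c d → a - b + (c - d) ≡ a + c - (b + d)
    interchange = solve-∀

  sumToℤ-pos : ∀ f n → sumToℤ (λ k → + f k) n ≡ + sumTo f n
  sumToℤ-pos f zero    = refl
  sumToℤ-pos f (suc n) = trans (cong (_+ + f (suc n)) (sumToℤ-pos f n)) (sym (pos-+ (sumTo f n) (f (suc n))))

  sumToℤ-telescope : ∀ (G : ℕ → ℤ) n → sumToℤ (λ k → G (suc k) - G k) n ≡ G (suc n) - G 0
  sumToℤ-telescope G zero    = refl
  sumToℤ-telescope G (suc n) = trans (cong (_+ (G (suc (suc n)) - G (suc n))) (sumToℤ-telescope G n))
                                     (cancel (G (suc (suc n))) (G (suc n)) (G 0))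
    where
    cancel : ∀ a b c → b - c + (a - b) ≡ a - c
    cancel = solve-∀

  sumToℤ-beyond-support : ∀ {f n} → (∀ k → n ℕ.< k → f k ≡ 0ℤ) → ∀ i → sumToℤ f (i ℕ.+ n) ≡ sumToℤ f n
  sumToℤ-beyond-support         f≡0 zero    = refl
  sumToℤ-beyond-support {f} {n} f≡0 (suc i) = begin
    sumToℤ f (i ℕ.+ n) + f (suc (i ℕ.+ n)) ≡⟨ cong (λ x → sumToℤ f (i ℕ.+ n) + x) (f≡0 _ (ℕ.s≤s (ℕ.m≤n+m n i))) ⟩
    sumToℤ f (i ℕ.+ n) + 0ℤ               ≡⟨ +-identityʳ _ ⟩
    sumToℤ f (i ℕ.+ n)                    ≡⟨ sumToℤ-beyond-support f≡0 i ⟩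
    sumToℤ f n                            ∎

  -- Creative telescoping

  X : ℕ → ℕ → ℕ
  X n k = ((n C k) ^ 2) ℕ.* ((2 ℕ.* k) C k)

  A : ℕ → ℕ
  A n = sumTo (X n) n

  X-vanishes : ∀ {n k} → n ℕ.< k → X n k ≡ 0
  X-vanishes n<k rewrite k>n⇒nCk≡0 n<k = refl

  sumToℤ-X≡A : ∀ n i → sumToℤ (λ k → + X n k) (i ℕ.+ n) ≡ + A n
  sumToℤ-X≡A n i = trans (sumToℤ-beyond-support (λ k n<k → cong +_ (X-vanishes n<k)) i) (sumToℤ-pos (X n) n)

  pos-X : ∀ n k → + X n k ≡ + (n C k) * + (n C k) * + ((2 ℕ.* k) C k)
  pos-X n k = begin
    + X n k                                             ≡⟨ pos-* ((n C k) ^ 2) ((2 ℕ.* k) C k) ⟩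
    + ((n C k) ^ 2) * + ((2 ℕ.* k) C k)                 ≡⟨ cong (λ m → + ((n C k) ℕ.* m) * + ((2 ℕ.* k) C k)) (ℕ.*-identityʳ (n C k)) ⟩
    + ((n C k) ℕ.* (n C k)) * + ((2 ℕ.* k) C k)         ≡⟨ cong (_* + ((2 ℕ.* k) C k)) (pos-* (n C k) (n C k)) ⟩
    + (n C k) * + (n C k) * + ((2 ℕ.* k) C k)           ∎

  pos-*-cong : ∀ a b c d → a ℕ.* b ≡ c ℕ.* d → + a * + b ≡ + c * + d
  pos-*-cong a b c d eq = trans (sym (pos-* a b)) (trans (cong +_ eq) (pos-* c d))

  x+y≡z⇒x≡z-y : ∀ {x y z} → x + y ≡ z → x ≡ z - y
  x+y≡z⇒x≡z-y {x} {y} refl = sym (cancel x y)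
    where
    cancel : ∀ x y → x + y - y ≡ x
    cancel = solve-∀

  [k+1]*mC[k+1]≡[m-k]*mCk : ∀ m k → + suc k * + (m C suc k) ≡ (+ m - + k) * + (m C k)
  [k+1]*mC[k+1]≡[m-k]*mCk m k = begin
    + suc k * + (m C suc k)                    ≡⟨ x+y≡z⇒x≡z-y summed ⟩
    + suc m * + (m C k) - + suc k * + (m C k)  ≡⟨ factor (+ m) (+ k) (+ (m C k)) ⟩
    (+ m - + k) * + (m C k)                    ∎
    where
    summed : + suc k * + (m C suc k) + + suc k * + (m C k) ≡ + suc m * + (m C k)
    summed = begin
      + suc k * + (m C suc k) + + suc k * + (m C k)       ≡⟨ cong₂ _+_ (sym (pos-* (suc k) (m C suc k))) (sym (pos-* (suc k) (m C k))) ⟩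
      + (suc k ℕ.* (m C suc k) ℕ.+ suc k ℕ.* (m C k))    ≡⟨ cong +_ ([k+1]*nC[k+1]+[k+1]*nCk≡[n+1]*nCk m k) ⟩
      + (suc m ℕ.* (m C k))                              ≡⟨ pos-* (suc m) (m C k) ⟩
      + suc m * + (m C k)                                ∎
    factor : ∀ M K c → (+ 1 + M) * c - (+ 1 + K) * c ≡ (M - K) * c
    factor = solve-∀

  [m+1]*mCk≡[m+1-k]*[m+1]Ck : ∀ m k → + suc m * + (m C k) ≡ (+ suc m - + k) * + (suc m C k)
  [m+1]*mCk≡[m+1-k]*[m+1]Ck m k = begin
    + suc m * + (m C k)                             ≡⟨ x+y≡z⇒x≡z-y summed ⟩
    + suc m * + (suc m C k) - + k * + (suc m C k)   ≡⟨ factor (+ suc m) (+ k) (+ (suc m C k)) ⟩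
    (+ suc m - + k) * + (suc m C k)                 ∎
    where
    summed : + suc m * + (m C k) + + k * + (suc m C k) ≡ + suc m * + (suc m C k)
    summed = begin
      + suc m * + (m C k) + + k * + (suc m C k)       ≡⟨ cong₂ _+_ (sym (pos-* (suc m) (m C k))) (sym (pos-* k (suc m C k))) ⟩
      + (suc m ℕ.* (m C k) ℕ.+ k ℕ.* (suc m C k))    ≡⟨ cong +_ (ℕ.+-comm _ (k ℕ.* (suc m C k))) ⟩
      + (k ℕ.* (suc m C k) ℕ.+ suc m ℕ.* (m C k))    ≡⟨ cong +_ (sym ([n+1]*[n+1]Ck≡k*[n+1]Ck+[n+1]*nCk m k)) ⟩
      + (suc m ℕ.* (suc m C k))                      ≡⟨ pos-* (suc m) (suc m C k) ⟩
      + suc m * + (suc m C k)                        ∎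
    factor : ∀ M K c → M * c - K * c ≡ (M - K) * c
    factor = solve-∀

  p*p*p*[c*c*z]≡u*u*v : ∀ p c z {u v} → p * c ≡ u → p * z ≡ v → p * p * p * (c * c * z) ≡ u * u * v
  p*p*p*[c*c*z]≡u*u*v p c z refl refl = regroup p c z
    where
    regroup : ∀ p c z → p * p * p * (c * c * z) ≡ (p * c) * (p * c) * (p * z)
    regroup = solve-∀

  -- Multiplied by (j+1)³ (n+1)², the terms X (n+2) (j+1), X (n+1) (j+1) and X n (j+1) become
  -- polynomial multiples of X (n+1) j, so a telescoping identity at k = j+1 reduces to a
  -- polynomial identity in n and j.
  module TermRatios (n j : ℕ) where

    private
      N J p q T w z W X₂ X₁ X₀ : ℤ
      N = + n
      J = + j
      p = + suc j
      q = + suc n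
      T = + 2 * (+ 2 * J + + 1)
      w = + (suc n C j)
      z = + ((2 ℕ.* j) C j)
      W = + X (suc n) j
      X₂ = + X (suc (suc n)) (suc j)
      X₁ = + X (suc n) (suc j)
      X₀ = + X n (suc j)

      W≡ : W ≡ w * w * z
      W≡ = pos-X (suc n) j

      regroup : ∀ a t w z → (a * w) * (a * w) * (t * z) ≡ a * a * t * (w * w * z)
      regroup = solve-∀

      absorption : p * + (suc (suc n) C suc j) ≡ (+ 2 + N) * w
      absorption = pos-*-cong (suc j) (suc (suc n) C suc j) (suc (suc n)) (suc n C j) ([k+1]*[n+1]C[k+1]≡[n+1]*nCk (suc n) j)

      central : p * + ((2 ℕ.* suc j) C suc j) ≡ T * z
      central = begin
        p * + ((2 ℕ.* suc j) C suc j)        ≡⟨ pos-*-cong (suc j) ((2 ℕ.* suc j) C suc j) (2 ℕ.* (2 ℕ.* j ℕ.+ 1)) ((2 ℕ.* j) C j) ([k+1]*[2k+2]C[k+1]≡2*[2k+1]*[2k]Ck j) ⟩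
        + (2 ℕ.* (2 ℕ.* j ℕ.+ 1)) * z        ≡⟨ cong (_* z) (pos-* 2 (2 ℕ.* j ℕ.+ 1)) ⟩
        + 2 * + (2 ℕ.* j ℕ.+ 1) * z          ≡⟨ cong (λ t → + 2 * t * z) (pos-+ (2 ℕ.* j) 1) ⟩
        + 2 * (+ (2 ℕ.* j) + + 1) * z        ≡⟨ cong (λ t → + 2 * (t + + 1) * z) (pos-* 2 j) ⟩
        T * z                                ∎

    X[n+2,j+1] : p * p * p * + X (suc (suc n)) (suc j) ≡ (+ 2 + N) * (+ 2 + N) * T * W
    X[n+2,j+1] = begin
      p * p * p * + X (suc (suc n)) (suc j)     ≡⟨ cong (p * p * p *_) (pos-X (suc (suc n)) (suc j)) ⟩
      p * p * p * (c * c * zz)                  ≡⟨ p*p*p*[c*c*z]≡u*u*v p c zz absorption central ⟩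
      ((+ 2 + N) * w) * ((+ 2 + N) * w) * (T * z) ≡⟨ regroup (+ 2 + N) T w z ⟩
      (+ 2 + N) * (+ 2 + N) * T * (w * w * z)   ≡⟨ cong ((+ 2 + N) * (+ 2 + N) * T *_) (sym W≡) ⟩
      (+ 2 + N) * (+ 2 + N) * T * W             ∎
      where
      c zz : ℤ
      c  = + (suc (suc n) C suc j)
      zz = + ((2 ℕ.* suc j) C suc j)

    X[n+1,j+1] : p * p * p * + X (suc n) (suc j) ≡ (q - J) * (q - J) * T * W
    X[n+1,j+1] = begin
      p * p * p * + X (suc n) (suc j)           ≡⟨ cong (p * p * p *_) (pos-X (suc n) (suc j)) ⟩
      p * p * p * (c * c * zz)                  ≡⟨ p*p*p*[c*c*z]≡u*u*v p c zz ([k+1]*mC[k+1]≡[m-k]*mCk (suc n) j) central ⟩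
      ((q - J) * w) * ((q - J) * w) * (T * z)   ≡⟨ regroup (q - J) T w z ⟩
      (q - J) * (q - J) * T * (w * w * z)       ≡⟨ cong ((q - J) * (q - J) * T *_) (sym W≡) ⟩
      (q - J) * (q - J) * T * W                 ∎
      where
      c zz : ℤ
      c  = + (suc n C suc j)
      zz = + ((2 ℕ.* suc j) C suc j)

    X[n,j+1] : p * p * p * (q * q * + X n (suc j)) ≡ (N - J) * (q - J) * ((N - J) * (q - J)) * T * W
    X[n,j+1] = begin
      p * p * p * (q * q * + X n (suc j))                  ≡⟨ cong (λ t → p * p * p * (q * q * t)) (pos-X n (suc j)) ⟩
      p * p * p * (q * q * (c * c * zz))                   ≡⟨ cong (p * p * p *_) (pull q c zz) ⟩
      p * p * p * ((q * c) * (q * c) * zz)                 ≡⟨ p*p*p*[c*c*z]≡u*u*v p (q * c) zz pqc central ⟩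
      (a * w) * (a * w) * (T * z)                          ≡⟨ regroup a T w z ⟩
      a * a * T * (w * w * z)                              ≡⟨ cong ((N - J) * (q - J) * ((N - J) * (q - J)) * T *_) (sym W≡) ⟩
      (N - J) * (q - J) * ((N - J) * (q - J)) * T * W      ∎
      where
      a c zz : ℤ
      a  = (N - J) * (q - J)
      c  = + (n C suc j)
      zz = + ((2 ℕ.* suc j) C suc j)
      pull : ∀ q c zz → q * q * (c * c * zz) ≡ (q * c) * (q * c) * zz
      pull = solve-∀
      swap : ∀ p q c → p * (q * c) ≡ q * (p * c)
      swap = solve-∀
      pqc : p * (q * c) ≡ (N - J) * (q - J) * w
      pqc = begin
        p * (q * c)                   ≡⟨ swap p q c ⟩
        q * (p * c)                   ≡⟨ cong (q *_) ([k+1]*mC[k+1]≡[m-k]*mCk n j) ⟩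
        q * ((N - J) * + (n C j))     ≡⟨ swap q (N - J) (+ (n C j)) ⟩
        (N - J) * (q * + (n C j))     ≡⟨ cong ((N - J) *_) ([m+1]*mCk≡[m+1-k]*[m+1]Ck n j) ⟩
        (N - J) * ((q - J) * w)       ≡⟨ assoc (N - J) (q - J) w ⟩
        (N - J) * (q - J) * w         ∎
        where
        assoc : ∀ a b c → a * (b * c) ≡ a * b * c
        assoc = solve-∀

    vanishing-combination : ∀ c₂ c₁ c₀ c →
      q * q * c₂ * ((+ 2 + N) * (+ 2 + N) * T) + q * q * c₁ * ((q - J) * (q - J) * T)
        + c₀ * ((N - J) * (q - J) * ((N - J) * (q - J)) * T) + p * p * p * (q * q * c) ≡ 0ℤ →
      c₂ * X₂ + c₁ * X₁ + c₀ * X₀ + c * W ≡ 0ℤ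
    vanishing-combination c₂ c₁ c₀ c certificate = *-cancelˡ-≡ (p * p * p * (q * q)) _ 0ℤ (begin
      p * p * p * (q * q) * (c₂ * X₂ + c₁ * X₁ + c₀ * X₀ + c * W)
        ≡⟨ spread p q c₂ c₁ c₀ c X₂ X₁ X₀ W ⟩
      q * q * c₂ * (p * p * p * X₂) + q * q * c₁ * (p * p * p * X₁) + c₀ * (p * p * p * (q * q * X₀)) + p * p * p * (q * q * c) * W
        ≡⟨ cong₃ (λ a b d → q * q * c₂ * a + q * q * c₁ * b + c₀ * d + p * p * p * (q * q * c) * W) X[n+2,j+1] X[n+1,j+1] X[n,j+1] ⟩
      q * q * c₂ * (P₂ * W) + q * q * c₁ * (P₁ * W) + c₀ * (P₀ * W) + p * p * p * (q * q * c) * W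
        ≡⟨ collect (q * q * c₂) (q * q * c₁) c₀ (p * p * p * (q * q * c)) P₂ P₁ P₀ W ⟩
      (q * q * c₂ * P₂ + q * q * c₁ * P₁ + c₀ * P₀ + p * p * p * (q * q * c)) * W
        ≡⟨ cong (_* W) certificate ⟩
      0ℤ * W
        ≡⟨ sym (*-zeroʳ (p * p * p * (q * q))) ⟩
      p * p * p * (q * q) * 0ℤ
        ∎)
      where
      P₂ P₁ P₀ : ℤ
      P₂ = (+ 2 + N) * (+ 2 + N) * T
      P₁ = (q - J) * (q - J) * T
      P₀ = (N - J) * (q - J) * ((N - J) * (q - J)) * T
      spread : ∀ p q c₂ c₁ c₀ c X₂ X₁ X₀ W →
        p * p * p * (q * q) * (c₂ * X₂ + c₁ * X₁ + c₀ * X₀ + c * W)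
          ≡ q * q * c₂ * (p * p * p * X₂) + q * q * c₁ * (p * p * p * X₁) + c₀ * (p * p * p * (q * q * X₀)) + p * p * p * (q * q * c) * W
      spread = solve-∀
      collect : ∀ a b c d P₂ P₁ P₀ W → a * (P₂ * W) + b * (P₁ * W) + c * (P₀ * W) + d * W ≡ (a * P₂ + b * P₁ + c * P₀ + d) * W
      collect = solve-∀

  recurrence : ℤ → ℤ → ℤ → ℤ → ℤ
  recurrence N a b c = (+ 2 + N) * (+ 2 + N) * c - (+ 10 * N * N + + 30 * N + + 23) * b + + 9 * (+ 1 + N) * (+ 1 + N) * a

  g : ℤ → ℤ → ℤ
  g N K = + 12 * K * K - (+ 16 * N + + 38) * K + + 8 * N + + 16

  G : ℕ → ℕ → ℤ
  G n zero    = 0ℤ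
  G n (suc k) = g (+ n) (+ suc k) * + X (suc n) k

  -- The ring solver does not unfold definitions, so certificates restate their polynomials with let.
  recurrence-certificate : ∀ N J →
    let p = + 1 + J ; q = + 1 + N ; T = + 2 * (+ 2 * J + + 1)
        g′ = λ K → + 12 * K * K - (+ 16 * N + + 38) * K + + 8 * N + + 16
    in q * q * ((+ 2 + N) * (+ 2 + N)) * ((+ 2 + N) * (+ 2 + N) * T)
       + q * q * (- (+ 10 * N * N + + 30 * N + + 23) - g′ (+ 2 + J)) * ((q - J) * (q - J) * T)
       + + 9 * (+ 1 + N) * (+ 1 + N) * ((N - J) * (q - J) * ((N - J) * (q - J)) * T)
       + p * p * p * (q * q * g′ (+ 1 + J)) ≡ 0ℤ
  recurrence-certificate = solve-∀

  recurrence-summand : ∀ n k → recurrence (+ n) (+ X n k) (+ X (suc n) k) (+ X (suc (suc n)) k) ≡ G n (suc k) - G n k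
  recurrence-summand n zero    = base (+ n)
    where
    base : ∀ N → (+ 2 + N) * (+ 2 + N) * + 1 - (+ 10 * N * N + + 30 * N + + 23) * + 1 + + 9 * (+ 1 + N) * (+ 1 + N) * + 1
                  ≡ (+ 12 * + 1 * + 1 - (+ 16 * N + + 38) * + 1 + + 8 * N + + 16) * + 1 - 0ℤ
    base = solve-∀
  recurrence-summand n (suc j) = i-j≡0⇒i≡j _ _ (trans
      (regroup a₂ b a₀ g₂ g₁ (+ X (suc (suc n)) (suc j)) (+ X (suc n) (suc j)) (+ X n (suc j)) (+ X (suc n) j))
      (vanishing-combination a₂ (- b - g₂) a₀ g₁ (recurrence-certificate N (+ j))))
    where
    open TermRatios n j
    N a₂ b a₀ g₂ g₁ : ℤ
    N  = + n
    a₂ = (+ 2 + N) * (+ 2 + N)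
    b  = + 10 * N * N + + 30 * N + + 23
    a₀ = + 9 * (+ 1 + N) * (+ 1 + N)
    g₂ = g N (+ suc (suc j))
    g₁ = g N (+ suc j)
    regroup : ∀ a₂ b a₀ g₂ g₁ X₂ X₁ X₀ W →
      a₂ * X₂ - b * X₁ + a₀ * X₀ - (g₂ * X₁ - g₁ * W) ≡ a₂ * X₂ + (- b - g₂) * X₁ + a₀ * X₀ + g₁ * W
    regroup = solve-∀

  weight : ℕ → ℕ → ℤ
  weight n k = (+ 3 * + k - + 2 * + n) * + X n k

  h : ℤ → ℤ → ℤ
  h N K = + 2 * (+ 2 + N) * (+ 2 + N) - + 4 * (+ 2 + N) * (+ 3 + N) * K + (+ 8 * N + + 18) * K * K - + 4 * K * K * K

  H : ℕ → ℕ → ℤ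
  H n zero    = 0ℤ
  H n (suc k) = h (+ n) (+ suc k) * + X (suc n) k

  weight-certificate : ∀ N J →
    let p = + 1 + J ; q = + 1 + N ; T = + 2 * (+ 2 * J + + 1)
        h′ = λ K → + 2 * (+ 2 + N) * (+ 2 + N) - + 4 * (+ 2 + N) * (+ 3 + N) * K + (+ 8 * N + + 18) * K * K - + 4 * K * K * K
    in q * q * 0ℤ * ((+ 2 + N) * (+ 2 + N) * T)
       + q * q * (q * q * (+ 3 * p - + 2 * q) - h′ (+ 2 + J)) * ((q - J) * (q - J) * T)
       + - (q * q * (+ 3 * p - + 2 * N)) * ((N - J) * (q - J) * ((N - J) * (q - J)) * T)
       + p * p * p * (q * q * h′ (+ 1 + J)) ≡ 0ℤ
  weight-certificate = solve-∀

  weight-summand : ∀ n k → + suc n * + suc n * (weight (suc n) k - weight n k) ≡ H n (suc k) - H n k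
  weight-summand n zero    = base (+ n)
    where
    base : ∀ N → (+ 1 + N) * (+ 1 + N) * ((+ 3 * + 0 - + 2 * (+ 1 + N)) * + 1 - (+ 3 * + 0 - + 2 * N) * + 1)
                  ≡ (+ 2 * (+ 2 + N) * (+ 2 + N) - + 4 * (+ 2 + N) * (+ 3 + N) * + 1 + (+ 8 * N + + 18) * + 1 * + 1 - + 4 * + 1 * + 1 * + 1) * + 1 - 0ℤ
    base = solve-∀
  weight-summand n (suc j) = i-j≡0⇒i≡j _ _ (trans
      (regroup q u v h₂ h₁ (+ X (suc (suc n)) (suc j)) (+ X (suc n) (suc j)) (+ X n (suc j)) (+ X (suc n) j))
      (vanishing-combination 0ℤ (q * q * u - h₂) (- (q * q * v)) h₁ (weight-certificate N (+ j))))
    where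
    open TermRatios n j
    N q u v h₂ h₁ : ℤ
    N  = + n
    q  = + suc n
    u  = + 3 * + suc j - + 2 * q
    v  = + 3 * + suc j - + 2 * N
    h₂ = h N (+ suc (suc j))
    h₁ = h N (+ suc j)
    regroup : ∀ q u v h₂ h₁ X₂ X₁ X₀ W →
      q * q * (u * X₁ - v * X₀) - (h₂ * X₁ - h₁ * W) ≡ 0ℤ * X₂ + (q * q * u - h₂) * X₁ + - (q * q * v) * X₀ + h₁ * W
    regroup = solve-∀

  sumToℤ-linear : ∀ a b c f g h m →
    sumToℤ (λ k → a * f k - b * g k + c * h k) m ≡ a * sumToℤ f m - b * sumToℤ g m + c * sumToℤ h m
  sumToℤ-linear a b c f g h zero    = refl
  sumToℤ-linear a b c f g h (suc m) = trans
    (cong (_+ (a * f (suc m) - b * g (suc m) + c * h (suc m))) (sumToℤ-linear a b c f g h m))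
    (distrib a b c (sumToℤ f m) (sumToℤ g m) (sumToℤ h m) (f (suc m)) (g (suc m)) (h (suc m)))
    where
    distrib : ∀ a b c F G H f g h → a * F - b * G + c * H + (a * f - b * g + c * h) ≡ a * (F + f) - b * (G + g) + c * (H + h)
    distrib = solve-∀

  G-vanishes : ∀ n k → suc n ℕ.< k → G n (suc k) ≡ 0ℤ
  G-vanishes n k n<k rewrite X-vanishes n<k = *-zeroʳ (g (+ n) (+ suc k))

  H-vanishes : ∀ n k → suc n ℕ.< k → H n (suc k) ≡ 0ℤ
  H-vanishes n k n<k rewrite X-vanishes n<k = *-zeroʳ (h (+ n) (+ suc k))

  weight-vanishes : ∀ n k → n ℕ.< k → weight n k ≡ 0ℤ
  weight-vanishes n k n<k rewrite X-vanishes n<k = *-zeroʳ (+ 3 * + k - + 2 * + n)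

  A-recurrence : ∀ n → recurrence (+ n) (+ A n) (+ A (suc n)) (+ A (suc (suc n))) ≡ 0ℤ
  A-recurrence n = begin
    a₂ * + A (suc (suc n)) - b * + A (suc n) + a₀ * + A n
      ≡⟨ cong₃ (λ x y z → a₂ * x - b * y + a₀ * z) (sumToℤ-X≡A (suc (suc n)) 0) (sumToℤ-X≡A (suc n) 1) (sumToℤ-X≡A n 2) ⟨
    a₂ * sumToℤ (λ k → + X (suc (suc n)) k) m - b * sumToℤ (λ k → + X (suc n) k) m + a₀ * sumToℤ (λ k → + X n k) m
      ≡⟨ sumToℤ-linear a₂ b a₀ _ _ _ m ⟨
    sumToℤ (λ k → a₂ * + X (suc (suc n)) k - b * + X (suc n) k + a₀ * + X n k) m
      ≡⟨ sumToℤ-cong (recurrence-summand n) m ⟩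
    sumToℤ (λ k → G n (suc k) - G n k) m
      ≡⟨ sumToℤ-telescope (G n) m ⟩
    G n (suc m) - 0ℤ
      ≡⟨ cong (_- 0ℤ) (G-vanishes n m (ℕ.n<1+n (suc n))) ⟩
    0ℤ
      ∎
    where
    m : ℕ
    m = suc (suc n)
    N a₂ b a₀ : ℤ
    N  = + n
    a₂ = (+ 2 + N) * (+ 2 + N)
    b  = + 10 * N * N + + 30 * N + + 23
    a₀ = + 9 * (+ 1 + N) * (+ 1 + N)

  weight-sum-step : ∀ n → sumToℤ (weight (suc n)) (suc n) ≡ sumToℤ (weight n) n
  weight-sum-step n = i-j≡0⇒i≡j _ _ (*-cancelˡ-≡ (q * q) _ 0ℤ (begin
    q * q * (sumToℤ (weight (suc n)) (suc n) - sumToℤ (weight n) n)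
      ≡⟨ cong₂ (λ x y → q * q * (x - y))
           (sumToℤ-beyond-support (weight-vanishes (suc n)) 1)
           (sumToℤ-beyond-support (weight-vanishes n) 2) ⟨
    q * q * (sumToℤ (weight (suc n)) m - sumToℤ (weight n) m)
      ≡⟨ cong (q * q *_) (sumToℤ-- (weight (suc n)) (weight n) m) ⟨
    q * q * sumToℤ (λ k → weight (suc n) k - weight n k) m
      ≡⟨ sumToℤ-*ˡ (q * q) _ m ⟨
    sumToℤ (λ k → q * q * (weight (suc n) k - weight n k)) m
      ≡⟨ sumToℤ-cong (weight-summand n) m ⟩
    sumToℤ (λ k → H n (suc k) - H n k) m
      ≡⟨ sumToℤ-telescope (H n) m ⟩
    H n (suc m) - 0ℤ
      ≡⟨ cong (_- 0ℤ) (H-vanishes n m (ℕ.n<1+n (suc n))) ⟩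
    0ℤ
      ≡⟨ *-zeroʳ (q * q) ⟨
    q * q * 0ℤ
      ∎))
    where
    m : ℕ
    m = suc (suc n)
    q : ℤ
    q = + suc n

  weight-sum : ∀ n → sumToℤ (weight n) n ≡ 0ℤ
  weight-sum zero    = refl
  weight-sum (suc n) = trans (weight-sum-step n) (weight-sum n)

  3S≡[4n+3]A : ∀ n → + 3 * + S n ≡ (+ 4 * + n + + 3) * + A n
  3S≡[4n+3]A n = begin
    + 3 * + S n
      ≡⟨ cong (+ 3 *_) (sumToℤ-pos _ n) ⟨
    + 3 * sumToℤ (λ k → + (X n k ℕ.* (2 ℕ.* k ℕ.+ 1))) n
      ≡⟨ sumToℤ-*ˡ (+ 3) _ n ⟨
    sumToℤ (λ k → + 3 * + (X n k ℕ.* (2 ℕ.* k ℕ.+ 1))) n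
      ≡⟨ sumToℤ-cong split n ⟩
    sumToℤ (λ k → (+ 4 * + n + + 3) * + X n k + + 2 * weight n k) n
      ≡⟨ sumToℤ-+ _ _ n ⟩
    sumToℤ (λ k → (+ 4 * + n + + 3) * + X n k) n + sumToℤ (λ k → + 2 * weight n k) n
      ≡⟨ cong₂ _+_ (sumToℤ-*ˡ (+ 4 * + n + + 3) (λ k → + X n k) n) (sumToℤ-*ˡ (+ 2) (weight n) n) ⟩
    (+ 4 * + n + + 3) * sumToℤ (λ k → + X n k) n + + 2 * sumToℤ (weight n) n
      ≡⟨ cong₂ (λ x y → (+ 4 * + n + + 3) * x + + 2 * y) (sumToℤ-pos (X n) n) (weight-sum n) ⟩
    (+ 4 * + n + + 3) * + A n + + 2 * 0ℤ
      ≡⟨ +-identityʳ _ ⟩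
    (+ 4 * + n + + 3) * + A n
      ∎
    where
    split : ∀ k → + 3 * + (X n k ℕ.* (2 ℕ.* k ℕ.+ 1)) ≡ (+ 4 * + n + + 3) * + X n k + + 2 * weight n k
    split k = begin
      + 3 * + (X n k ℕ.* (2 ℕ.* k ℕ.+ 1))         ≡⟨ cong (+ 3 *_) (pos-* (X n k) (2 ℕ.* k ℕ.+ 1)) ⟩
      + 3 * (+ X n k * + (2 ℕ.* k ℕ.+ 1))         ≡⟨ cong (λ t → + 3 * (+ X n k * t)) (pos-+ (2 ℕ.* k) 1) ⟩
      + 3 * (+ X n k * (+ (2 ℕ.* k) + + 1))       ≡⟨ cong (λ t → + 3 * (+ X n k * (t + + 1))) (pos-* 2 k) ⟩
      + 3 * (+ X n k * (+ 2 * + k + + 1))         ≡⟨ rearrange (+ X n k) (+ k) (+ n) ⟩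
      (+ 4 * + n + + 3) * + X n k + + 2 * weight n k ∎
      where
      rearrange : ∀ x K N → + 3 * (x * (+ 2 * K + + 1)) ≡ (+ 4 * N + + 3) * x + + 2 * ((+ 3 * K - + 2 * N) * x)
      rearrange = solve-∀

  0≤+ : ∀ {n} → 0ℤ ≤ + n
  0≤+ = +≤+ z≤n

  0<+[1+] : ∀ {n} → 0ℤ < + suc n
  0<+[1+] = +<+ (s≤s z≤n)

  *-nonNeg : ∀ {i j} → 0ℤ ≤ i → 0ℤ ≤ j → 0ℤ ≤ i * j
  *-nonNeg {i} 0≤i 0≤j = subst (_≤ i * _) (*-zeroʳ i) (*-monoˡ-≤-nonNeg i {{nonNegative 0≤i}} 0≤j)

  *-pos : ∀ {i j} → 0ℤ < i → 0ℤ < j → 0ℤ < i * j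
  *-pos {i} 0<i 0<j = subst (_< i * _) (*-zeroʳ i) (*-monoˡ-<-pos i {{positive 0<i}} 0<j)

  *-cancelˡ-nonNeg : ∀ {c i} → 0ℤ < c → 0ℤ ≤ c * i → 0ℤ ≤ i
  *-cancelˡ-nonNeg {c} {i} 0<c 0≤ci = *-cancelˡ-≤-pos 0ℤ i c {{positive 0<c}} (subst (_≤ c * i) (sym (*-zeroʳ c)) 0≤ci)

  *-cancelˡ-pos : ∀ {c i} → 0ℤ < c → 0ℤ < c * i → 0ℤ < i
  *-cancelˡ-pos {c} {i} 0<c 0<ci = *-cancelˡ-<-nonNeg c {{nonNegative (<⇒≤ 0<c)}} (subst (_< c * i) (sym (*-zeroʳ c)) 0<ci)

  0<a*t+[1+c] : ∀ a c t → 0ℤ < + a * + t + + suc c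
  0<a*t+[1+c] a c t = +-mono-≤-< (*-nonNeg (0≤+ {a}) (0≤+ {t})) (0<+[1+] {c})

  horner : List ℕ → ℤ → ℤ
  horner []           T = 0ℤ
  horner (c ∷ [])     T = + c
  horner (c ∷ d ∷ cs) T = + c + T * horner (d ∷ cs) T

  horner-nonNeg : ∀ cs t → 0ℤ ≤ horner cs (+ t)
  horner-nonNeg []           t = 0≤+
  horner-nonNeg (c ∷ [])     t = 0≤+
  horner-nonNeg (c ∷ d ∷ cs) t = +-mono-≤ (0≤+ {c}) (*-nonNeg (0≤+ {t}) (horner-nonNeg (d ∷ cs) t))

  constant-coefficient : List ℕ → ℕ
  constant-coefficient []      = 0
  constant-coefficient (c ∷ _) = c

  horner-pos : ∀ cs t .{{_ : ℕ.NonZero (constant-coefficient cs)}} → 0ℤ < horner cs (+ t)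
  horner-pos (suc c ∷ [])     t = 0<+[1+]
  horner-pos (suc c ∷ d ∷ cs) t = +-mono-<-≤ (0<+[1+] {c}) (*-nonNeg (0≤+ {t}) (horner-nonNeg (d ∷ cs) t))

  A-pos : ∀ n → 0ℤ < + A n
  A-pos n = +<+ (sumTo-f0 (X n) n)

  a+c*r≡a : ∀ a c {r} → r ≡ 0ℤ → a + c * r ≡ a
  a+c*r≡a a c refl = trans (cong (λ r → a + r) (*-zeroʳ c)) (+-identityʳ a)

  [2+T]² : ℤ → ℤ
  [2+T]² T = (+ 2 + T) * (+ 2 + T)

  [2+t]²-pos : ∀ t → 0ℤ < [2+T]² (+ t)
  [2+t]²-pos t = *-pos (0<+[1+] {suc t}) (0<+[1+] {suc t})

  -- Bounds along the recurrence

  -- For x = A (t+2) and y = A (t+1), nonnegativity of lowerGap and upperGap says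
  -- 9 − 6/(t+2)² ≤ S (t+2) / S (t+1) ≤ 9 − 9/(2(t+2)²); see S-gap-bound and S-gap-pos.
  lowerGap upperGap : ℤ → ℤ → ℤ → ℤ
  lowerGap T x y = [2+T]² T * (+ 4 * T + + 11) * x - (+ 9 * [2+T]² T - + 6) * (+ 4 * T + + 7) * y
  upperGap T x y = (+ 18 * [2+T]² T - + 9) * (+ 4 * T + + 7) * y - + 2 * [2+T]² T * (+ 4 * T + + 11) * x

  upper-step-certificate : ∀ T x y z →
    let sq    = λ T → (+ 2 + T) * (+ 2 + T)
        upper = λ T x y → (+ 18 * sq T - + 9) * (+ 4 * T + + 7) * y - + 2 * sq T * (+ 4 * T + + 11) * x
        rec   = λ N a b c → (+ 2 + N) * (+ 2 + N) * c - (+ 10 * N * N + + 30 * N + + 23) * b + + 9 * (+ 1 + N) * (+ 1 + N) * a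
    in + 2 * sq T * (+ 4 * T + + 11) * (upper (+ 1 + T) z x + + 2 * (+ 4 * T + + 15) * rec (+ 1 + T) y x z)
       ≡ (+ 207 + T * (+ 204 + T * (+ 70 + T * + 8))) * upper T x y + (+ 3753 + T * (+ 3528 + T * + 792)) * y
  upper-step-certificate = solve-∀

  lower-step-certificate : ∀ T x y z →
    let sq    = λ T → (+ 2 + T) * (+ 2 + T)
        lower = λ T x y → sq T * (+ 4 * T + + 11) * x - (+ 9 * sq T - + 6) * (+ 4 * T + + 7) * y
        rec   = λ N a b c → (+ 2 + N) * (+ 2 + N) * c - (+ 10 * N * N + + 30 * N + + 23) * b + + 9 * (+ 1 + N) * (+ 1 + N) * a
    in sq T * (+ 4 * T + + 11) * (lower (+ 1 + T) z x + - (+ 4 * T + + 15) * rec (+ 1 + T) y x z)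
       ≡ (+ 120 + T * (+ 108 + T * (+ 35 + T * + 4))) * lower T x y + (+ 1440 + T * (+ 4824 + T * (+ 4470 + T * (+ 1584 + T * + 192)))) * y
  lower-step-certificate = solve-∀

  A-upper : ∀ t → 0ℤ ≤ upperGap (+ t) (+ A (suc (suc t))) (+ A (suc t))
  A-upper zero    = +≤+ z≤n
  A-upper (suc t) = *-cancelˡ-nonNeg scale-pos (subst (0ℤ ≤_) (sym scaled)
      (+-mono-≤ (*-nonNeg (horner-nonNeg (207 ∷ 204 ∷ 70 ∷ 8 ∷ []) t) (A-upper t))
                (*-nonNeg (horner-nonNeg (3753 ∷ 3528 ∷ 792 ∷ []) t) (<⇒≤ (A-pos (suc t))))))
    where
    T x y z scale : ℤ
    T = + t
    x = + A (suc (suc t))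
    y = + A (suc t)
    z = + A (suc (suc (suc t)))
    scale = + 2 * [2+T]² T * (+ 4 * T + + 11)
    scale-pos : 0ℤ < scale
    scale-pos = *-pos (*-pos (0<+[1+] {1}) ([2+t]²-pos t)) (0<a*t+[1+c] 4 10 t)
    scaled : scale * upperGap (+ suc t) z x
             ≡ horner (207 ∷ 204 ∷ 70 ∷ 8 ∷ []) T * upperGap T x y + horner (3753 ∷ 3528 ∷ 792 ∷ []) T * y
    scaled = begin
      scale * upperGap (+ suc t) z x
        ≡⟨ cong (scale *_) (a+c*r≡a (upperGap (+ suc t) z x) (+ 2 * (+ 4 * T + + 15)) (A-recurrence (suc t))) ⟨
      scale * (upperGap (+ suc t) z x + + 2 * (+ 4 * T + + 15) * recurrence (+ suc t) y x z)
        ≡⟨ upper-step-certificate T x y z ⟩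
      horner (207 ∷ 204 ∷ 70 ∷ 8 ∷ []) T * upperGap T x y + horner (3753 ∷ 3528 ∷ 792 ∷ []) T * y
        ∎

  A-lower : ∀ t → 0ℤ ≤ lowerGap (+ t) (+ A (suc (suc t))) (+ A (suc t))
  A-lower zero    = +≤+ z≤n
  A-lower (suc t) = *-cancelˡ-nonNeg scale-pos (subst (0ℤ ≤_) (sym scaled)
      (+-mono-≤ (*-nonNeg (horner-nonNeg (120 ∷ 108 ∷ 35 ∷ 4 ∷ []) t) (A-lower t))
                (*-nonNeg (horner-nonNeg (1440 ∷ 4824 ∷ 4470 ∷ 1584 ∷ 192 ∷ []) t) (<⇒≤ (A-pos (suc t))))))
    where
    T x y z scale : ℤ
    T = + t
    x = + A (suc (suc t))
    y = + A (suc t)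
    z = + A (suc (suc (suc t)))
    scale = [2+T]² T * (+ 4 * T + + 11)
    scale-pos : 0ℤ < scale
    scale-pos = *-pos ([2+t]²-pos t) (0<a*t+[1+c] 4 10 t)
    scaled : scale * lowerGap (+ suc t) z x
             ≡ horner (120 ∷ 108 ∷ 35 ∷ 4 ∷ []) T * lowerGap T x y + horner (1440 ∷ 4824 ∷ 4470 ∷ 1584 ∷ 192 ∷ []) T * y
    scaled = begin
      scale * lowerGap (+ suc t) z x
        ≡⟨ cong (scale *_) (a+c*r≡a (lowerGap (+ suc t) z x) (- (+ 4 * T + + 15)) (A-recurrence (suc t))) ⟨
      scale * (lowerGap (+ suc t) z x + - (+ 4 * T + + 15) * recurrence (+ suc t) y x z)
        ≡⟨ lower-step-certificate T x y z ⟩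
      horner (120 ∷ 108 ∷ 35 ∷ 4 ∷ []) T * lowerGap T x y + horner (1440 ∷ 4824 ∷ 4470 ∷ 1584 ∷ 192 ∷ []) T * y
        ∎

  -- Once A (t+3) is eliminated with the recurrence, the bracket is a concave quadratic form in
  -- A (t+2) and A (t+1); the right-hand side writes it as a positive multiple of
  -- lowerGap · upperGap plus nonnegative terms.
  convexity-certificate : ∀ T x y z →
    let sq    = λ T → (+ 2 + T) * (+ 2 + T)
        lower = λ T x y → sq T * (+ 4 * T + + 11) * x - (+ 9 * sq T - + 6) * (+ 4 * T + + 7) * y
        upper = λ T x y → (+ 18 * sq T - + 9) * (+ 4 * T + + 7) * y - + 2 * sq T * (+ 4 * T + + 11) * x
        rec   = λ N a b c → (+ 2 + N) * (+ 2 + N) * c - (+ 10 * N * N + + 30 * N + + 23) * b + + 9 * (+ 1 + N) * (+ 1 + N) * a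
        uq    = + 4617 + T * (+ 11226 + T * (+ 9851 + T * (+ 4080 + T * (+ 816 + T * + 64))))
        w₂    = + 203283 + T * (+ 511794 + T * (+ 501417 + T * (+ 239868 + T * (+ 56232 + T * + 5184))))
    in + 4 * (sq T * sq T) * (+ 4 * T + + 11)
         * (sq (+ 1 + T) * ((+ 4 * T + + 7) * (+ 4 * T + + 15) * y * z - (+ 4 * T + + 11) * (+ 4 * T + + 11) * x * x)
            + - ((+ 4 * T + + 7) * (+ 4 * T + + 15) * y) * rec (+ 1 + T) y x z)
       ≡ + 2 * sq (+ 1 + T) * (+ 4 * T + + 11) * lower T x y * upper T x y + (+ 4 * T + + 7) * (uq * y * upper T x y + w₂ * (y * y))
  convexity-certificate = solve-∀

  A-convexity : ∀ t → let T = + t in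
    0ℤ < (+ 4 * T + + 7) * (+ 4 * T + + 15) * + A (suc t) * + A (suc (suc (suc t)))
         - (+ 4 * T + + 11) * (+ 4 * T + + 11) * + A (suc (suc t)) * + A (suc (suc t))
  A-convexity t = *-cancelˡ-pos [3+t]²-pos (*-cancelˡ-pos scale-pos
      (subst (0ℤ <_) (sym scaled) (+-mono-≤-< gaps-nonNeg remainder-pos)))
    where
    uq w₂ : List ℕ
    uq = 4617 ∷ 11226 ∷ 9851 ∷ 4080 ∷ 816 ∷ 64 ∷ []
    w₂ = 203283 ∷ 511794 ∷ 501417 ∷ 239868 ∷ 56232 ∷ 5184 ∷ []
    T x y z L U scale Q : ℤ
    T = + t
    x = + A (suc (suc t))
    y = + A (suc t)
    z = + A (suc (suc (suc t)))
    L = lowerGap T x y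
    U = upperGap T x y
    y-pos : 0ℤ < y
    y-pos = A-pos (suc t)
    [3+t]²-pos : 0ℤ < [2+T]² (+ suc t)
    [3+t]²-pos = [2+t]²-pos (suc t)
    scale = + 4 * ([2+T]² T * [2+T]² T) * (+ 4 * T + + 11)
    scale-pos : 0ℤ < scale
    scale-pos = *-pos (*-pos (0<+[1+] {3}) (*-pos ([2+t]²-pos t) ([2+t]²-pos t))) (0<a*t+[1+c] 4 10 t)
    Q = (+ 4 * T + + 7) * (+ 4 * T + + 15) * y * z - (+ 4 * T + + 11) * (+ 4 * T + + 11) * x * x
    gaps-nonNeg : 0ℤ ≤ + 2 * [2+T]² (+ suc t) * (+ 4 * T + + 11) * L * U
    gaps-nonNeg = *-nonNeg (*-nonNeg (<⇒≤ (*-pos (*-pos (0<+[1+] {1}) [3+t]²-pos) (0<a*t+[1+c] 4 10 t))) (A-lower t)) (A-upper t)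
    remainder-pos : 0ℤ < (+ 4 * T + + 7) * (horner uq T * y * U + horner w₂ T * (y * y))
    remainder-pos = *-pos (0<a*t+[1+c] 4 6 t)
      (+-mono-≤-< (*-nonNeg (*-nonNeg (horner-nonNeg uq t) (<⇒≤ y-pos)) (A-upper t)) (*-pos (horner-pos w₂ t) (*-pos y-pos y-pos)))
    scaled : scale * ([2+T]² (+ suc t) * Q)
             ≡ + 2 * [2+T]² (+ suc t) * (+ 4 * T + + 11) * L * U + (+ 4 * T + + 7) * (horner uq T * y * U + horner w₂ T * (y * y))
    scaled = begin
      scale * ([2+T]² (+ suc t) * Q)
        ≡⟨ cong (scale *_) (a+c*r≡a ([2+T]² (+ suc t) * Q) (- ((+ 4 * T + + 7) * (+ 4 * T + + 15) * y)) (A-recurrence (suc t))) ⟨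
      scale * ([2+T]² (+ suc t) * Q + - ((+ 4 * T + + 7) * (+ 4 * T + + 15) * y) * recurrence (+ suc t) y x z)
        ≡⟨ convexity-certificate T x y z ⟩
      + 2 * [2+T]² (+ suc t) * (+ 4 * T + + 11) * L * U + (+ 4 * T + + 7) * (horner uq T * y * U + horner w₂ T * (y * y))
        ∎

  -- The ratio S (n+1) / S n

  0<i-j⇒j<i : ∀ {i j} → 0ℤ < i - j → j < i
  0<i-j⇒j<i {i} {j} 0<i-j = subst₂ _<_ (+-identityʳ j) (cancel i j) (+-monoʳ-< j 0<i-j)
    where
    cancel : ∀ i j → j + (i - j) ≡ i
    cancel = solve-∀

  S-log-convex : ∀ n → + S (suc n) * + S (suc n) < + S (suc (suc n)) * + S n
  S-log-convex zero    = toWitness {a? = + S 1 * + S 1 <? + S 2 * + S 0} _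
  S-log-convex (suc t) = 0<i-j⇒j<i (*-cancelˡ-pos (0<+[1+] {8}) (subst (0ℤ <_) (sym nine-gap) (A-convexity t)))
    where
    T s₁ s₂ s₃ x y z : ℤ
    T  = + t
    x  = + A (suc (suc t))
    y  = + A (suc t)
    z  = + A (suc (suc (suc t)))
    s₁ = + S (suc t)
    s₂ = + S (suc (suc t))
    s₃ = + S (suc (suc (suc t)))
    expand : ∀ s₁ s₂ s₃ → + 9 * (s₃ * s₁ - s₂ * s₂) ≡ (+ 3 * s₃) * (+ 3 * s₁) - (+ 3 * s₂) * (+ 3 * s₂)
    expand = solve-∀
    collect : ∀ T x y z → ((+ 4 * (+ 3 + T) + + 3) * z) * ((+ 4 * (+ 1 + T) + + 3) * y) - ((+ 4 * (+ 2 + T) + + 3) * x) * ((+ 4 * (+ 2 + T) + + 3) * x)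
                        ≡ (+ 4 * T + + 7) * (+ 4 * T + + 15) * y * z - (+ 4 * T + + 11) * (+ 4 * T + + 11) * x * x
    collect = solve-∀
    nine-gap : + 9 * (s₃ * s₁ - s₂ * s₂) ≡ (+ 4 * T + + 7) * (+ 4 * T + + 15) * y * z - (+ 4 * T + + 11) * (+ 4 * T + + 11) * x * x
    nine-gap = begin
      + 9 * (s₃ * s₁ - s₂ * s₂)
        ≡⟨ expand s₁ s₂ s₃ ⟩
      (+ 3 * s₃) * (+ 3 * s₁) - (+ 3 * s₂) * (+ 3 * s₂)
        ≡⟨ cong₃ (λ a b c → a * b - c * c) (3S≡[4n+3]A (3 ℕ.+ t)) (3S≡[4n+3]A (suc t)) (3S≡[4n+3]A (2 ℕ.+ t)) ⟩
      ((+ 4 * (+ 3 + T) + + 3) * z) * ((+ 4 * (+ 1 + T) + + 3) * y) - ((+ 4 * (+ 2 + T) + + 3) * x) * ((+ 4 * (+ 2 + T) + + 3) * x)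
        ≡⟨ collect T x y z ⟩
      (+ 4 * T + + 7) * (+ 4 * T + + 15) * y * z - (+ 4 * T + + 11) * (+ 4 * T + + 11) * x * x
        ∎

  S-gap : ℕ → ℤ
  S-gap n = + 9 * + S n - + S (suc n)

  module _ (t : ℕ) where
    private
      T M s₁ s₂ x y : ℤ
      T  = + t
      M  = [2+T]² T
      s₁ = + S (suc t)
      s₂ = + S (suc (suc t))
      x  = + A (suc (suc t))
      y  = + A (suc t)

      3s₁ : + 3 * s₁ ≡ (+ 4 * (+ 1 + T) + + 3) * y
      3s₁ = 3S≡[4n+3]A (suc t)
      3s₂ : + 3 * s₂ ≡ (+ 4 * (+ 2 + T) + + 3) * x
      3s₂ = 3S≡[4n+3]A (suc (suc t))

    S-gap-bound : [2+T]² T * S-gap (suc t) ≤ + 6 * s₁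
    S-gap-bound = 0≤i-j⇒j≤i (*-cancelˡ-nonNeg (0<+[1+] {2}) (subst (0ℤ ≤_) in-S (A-lower t)))
      where
      regroup : ∀ M s₁ s₂ → M * (+ 3 * s₂) - (+ 9 * M - + 6) * (+ 3 * s₁) ≡ + 3 * (+ 6 * s₁ - M * (+ 9 * s₁ - s₂))
      regroup = solve-∀
      reassoc : ∀ M T x y → M * (+ 4 * T + + 11) * x - (+ 9 * M - + 6) * (+ 4 * T + + 7) * y
                            ≡ M * ((+ 4 * (+ 2 + T) + + 3) * x) - (+ 9 * M - + 6) * ((+ 4 * (+ 1 + T) + + 3) * y)
      reassoc = solve-∀
      in-S : lowerGap T x y ≡ + 3 * (+ 6 * s₁ - M * (+ 9 * s₁ - s₂))
      in-S = trans (reassoc M T x y)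
               (trans (cong₂ (λ a b → M * a - (+ 9 * M - + 6) * b) (sym 3s₂) (sym 3s₁)) (regroup M s₁ s₂))

    S-gap-pos : 0ℤ < S-gap (suc t)
    S-gap-pos = *-cancelˡ-pos 0<2M (<-≤-trans 0<9s₁ (0≤i-j⇒j≤i (*-cancelˡ-nonNeg (0<+[1+] {2}) (subst (0ℤ ≤_) in-S (A-upper t)))))
      where
      0<2M : 0ℤ < + 2 * M
      0<2M = *-pos (0<+[1+] {1}) ([2+t]²-pos t)
      0<9s₁ : 0ℤ < + 9 * s₁
      0<9s₁ = *-pos (0<+[1+] {8}) (+<+ (S-pos (suc t)))
      regroup : ∀ M s₁ s₂ → (+ 18 * M - + 9) * (+ 3 * s₁) - + 2 * M * (+ 3 * s₂) ≡ + 3 * (+ 2 * M * (+ 9 * s₁ - s₂) - + 9 * s₁)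
      regroup = solve-∀
      reassoc : ∀ M T x y → (+ 18 * M - + 9) * (+ 4 * T + + 7) * y - + 2 * M * (+ 4 * T + + 11) * x
                            ≡ (+ 18 * M - + 9) * ((+ 4 * (+ 1 + T) + + 3) * y) - + 2 * M * ((+ 4 * (+ 2 + T) + + 3) * x)
      reassoc = solve-∀
      in-S : upperGap T x y ≡ + 3 * (+ 2 * M * (+ 9 * s₁ - s₂) - + 9 * s₁)
      in-S = trans (reassoc M T x y)
               (trans (cong₂ (λ a b → (+ 18 * M - + 9) * a - + 2 * M * b) (sym 3s₁) (sym 3s₂)) (regroup M s₁ s₂))

  S-gap-small : ∀ t q P → 6 ℕ.* suc q ℕ.≤ suc t → 0ℤ < P → S-gap (suc t) * + suc q < P * + S (suc t)
  S-gap-small t q P 6q≤t+1 0<P = *-cancelˡ-<-nonNeg (+ 6) (subst (_< + 6 * (P * s₁)) (sym (swap D (+ suc q)))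
      (<-≤-trans (*-monoʳ-<-pos D {{positive (S-gap-pos t)}} 6q<M) (≤-trans (S-gap-bound t) (*-monoˡ-≤-nonNeg (+ 6) s₁≤Ps₁))))
    where
    s₁ D : ℤ
    s₁ = + S (suc t)
    D  = S-gap (suc t)
    swap : ∀ D Q → + 6 * (D * Q) ≡ + 6 * Q * D
    swap = solve-∀
    s₁≤Ps₁ : s₁ ≤ P * s₁
    s₁≤Ps₁ = subst (_≤ P * s₁) (*-identityˡ s₁) (*-monoʳ-≤-nonNeg s₁ (i<j⇒suc[i]≤j 0<P))
    6q<M : + (6 ℕ.* suc q) < [2+T]² (+ t)
    6q<M = +<+ (ℕ.<-≤-trans (s≤s 6q≤t+1) (ℕ.m≤m*n (suc (suc t)) (suc (suc t))))

open import Data.Nat as ℕ using (zero)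
import Data.Nat.Properties as ℕ
open import Data.Integer as ℤ using (ℤ)
import Data.Integer.Properties as ℤ
open import Data.Integer.Tactic.RingSolver
open import Data.Rational using (ℚ; mkℚ; _<_; _-_; ∣_∣; 0ℚ; _/_; ↥_; ↧_; ↧ₙ_; toℚᵘ)
import Data.Rational as ℚ
import Data.Rational.Properties as ℚ
import Data.Rational.Unnormalised as ℚᵘ
import Data.Rational.Unnormalised.Properties as ℚᵘ
open import Relation.Binary.PropositionalEquality using (_≡_; sym; trans; cong; subst)

toℚᵘ-/ : ∀ i n .{{_ : ℕ.NonZero n}} → toℚᵘ (i / n) ℚᵘ.≃ (i ℚᵘ./ n)
toℚᵘ-/ i (suc n) = ℚ.toℚᵘ-fromℚᵘ (ℚᵘ.mkℚᵘ i n)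

a*d<c*b⇒a/b<c/d : ∀ a b c d .{{_ : ℕ.NonZero b}} .{{_ : ℕ.NonZero d}} → a ℤ.* + d ℤ.< c ℤ.* + b → a / b < c / d
a*d<c*b⇒a/b<c/d a b@(suc _) c d@(suc _) ad<cb = ℚ.toℚᵘ-cancel-<
  (ℚᵘ.<-respˡ-≃ (ℚᵘ.≃-sym (toℚᵘ-/ a b)) (ℚᵘ.<-respʳ-≃ (ℚᵘ.≃-sym (toℚᵘ-/ c d)) (ℚᵘ.*<* ad<cb)))

∣a-c*b∣*↧ε<↥ε*b⇒∣a/b-c/1∣<ε : ∀ a b c ε .{{_ : ℕ.NonZero b}} → + ℤ.∣ a ℤ.- c ℤ.* + b ∣ ℤ.* ↧ ε ℤ.< ↥ ε ℤ.* + b → ∣ a / b - c / 1 ∣ < ε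
∣a-c*b∣*↧ε<↥ε*b⇒∣a/b-c/1∣<ε a b@(suc b-1) c ε@(mkℚ _ _ _) ineq = ℚ.toℚᵘ-cancel-< (ℚᵘ.<-respˡ-≃ (ℚᵘ.≃-sym distance) (ℚᵘ.*<* ineq))
  where
  common-denominator : a ℚᵘ./ b ℚᵘ.- c ℚᵘ./ 1 ℚᵘ.≃ (a ℤ.- c ℤ.* + b) ℚᵘ./ b
  common-denominator = ℚᵘ.*≡* (trans (regroup a c (+ b)) (cong (λ k → (a ℤ.- c ℤ.* + b) ℤ.* + suc k) (sym (ℕ.*-identityʳ b-1))))
    where
    regroup : ∀ a c B → (a ℤ.* + 1 ℤ.+ ℤ.- c ℤ.* B) ℤ.* B ≡ (a ℤ.- c ℤ.* B) ℤ.* B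
    regroup = solve-∀
  distance : toℚᵘ ∣ a / b - c / 1 ∣ ℚᵘ.≃ ℚᵘ.∣ (a ℤ.- c ℤ.* + b) ℚᵘ./ b ∣
  distance = ℚᵘ.≃-trans (ℚ.toℚᵘ-homo-∣-∣ (a / b - c / 1)) (ℚᵘ.∣-∣-cong (ℚᵘ.≃-trans (ℚ.toℚᵘ-homo-+ (a / b) (ℚ.- (c / 1)))
    (ℚᵘ.≃-trans (ℚᵘ.+-cong (toℚᵘ-/ a b) (ℚᵘ.≃-trans (ℚ.toℚᵘ-homo‿- (c / 1)) (ℚᵘ.-‿cong (toℚᵘ-/ c 1)))) common-denominator)))

ratio-increasing : ∀ n → ratio n < ratio (suc n)
ratio-increasing n = a*d<c*b⇒a/b<c/d (+ S (suc n)) (S n) (+ S (suc (suc n))) (S (suc n)) {{S-nonZero n}} {{S-nonZero (suc n)}} (S-log-convex n)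

ratio-close-to-9 : ∀ t ε → 0ℚ < ε → 6 ℕ.* ↧ₙ ε ≤ℕ suc t → ∣ ratio (suc t) - + 9 / 1 ∣ < ε
ratio-close-to-9 t ε@(mkℚ _ _ _) 0<ε 6q≤t+1 = ∣a-c*b∣*↧ε<↥ε*b⇒∣a/b-c/1∣<ε s₂ (S (suc t)) (+ 9) ε {{S-nonZero (suc t)}}
  (subst (λ v → v ℤ.* ↧ ε ℤ.< ↥ ε ℤ.* s₁) (sym ∣s₂-9s₁∣≡gap)
    (S-gap-small t (ℚ.denominator-1 ε) (↥ ε) 6q≤t+1 (ℤ.positive⁻¹ (↥ ε) {{ℚ.positive 0<ε}})))
  where
  s₁ s₂ : ℤ
  s₁ = + S (suc t)
  s₂ = + S (suc (suc t))
  ∣s₂-9s₁∣≡gap : + ℤ.∣ s₂ ℤ.- + 9 ℤ.* s₁ ∣ ≡ S-gap (suc t)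
  ∣s₂-9s₁∣≡gap = trans (cong +_ (ℤ.∣i-j∣≡∣j-i∣ s₂ (+ 9 ℤ.* s₁))) (ℤ.0≤i⇒+∣i∣≡i (ℤ.<⇒≤ (S-gap-pos t)))

corollary4p2 : ((n : ℕ) → ratio n < ratio (suc n))
    × ((ε : ℚ) → 0ℚ < ε → ∃ λ N → (n : ℕ) → N ≤ℕ n → ∣ ratio n - (+ 9 / 1) ∣ < ε)
corollary4p2 = ratio-increasing , λ ε 0<ε → 6 ℕ.* ↧ₙ ε , λ where
  zero    ()
  (suc t) N≤t+1 → ratio-close-to-9 t ε 0<ε N≤t+1
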